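{- If $C$ is a cycle graph with an even number of vertices, then $S(C)$ is planar.
   Context: For a graph $G$, the great shadow $S(G)$ is obtained from $G$ by introducing, for each vertex $v$, a new vertex $v'$ (the shadow vertex of $v$) adjacent to $v$ and to every neighbor of $v$ in $G$; $S(G)$ contains all edges of $G$ and no edges between shadow vertices. -}

module Defs where

open import Data.Nat using (ℕ; zero) renaming (suc to sucℕ)
open import Data.Fin using (Fin; toℕ)
open import Data.Sum using (_⊎_; inj₁; inj₂)
open import Data.Product using (_×_; _,_; Σ)
open import Data.Empty using (⊥)
open import Data.Integer using (ℤ; _-_; _*_; _≤_; _<_; _⊓_; _⊔_; 0ℤ)
open import Relation.Binary.PropositionalEquality using (_≡_; _≢_)
open import Relation.Nullary using (¬_)

record Graph : Set₁ where
  field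
    V   : Set
    Adj : V → V → Set
open Graph public

-- The cycle graph C_n on vertices 0,…,n-1 : i ~ j iff j = i+1 or i = j+1 (mod n).
-- (Meant for n ≥ 3, where this is the usual cycle graph.)
CycleAdj : (n : ℕ) → Fin n → Fin n → Set
CycleAdj n i j =
     (sucℕ (toℕ i) ≡ toℕ j)
  ⊎ (sucℕ (toℕ j) ≡ toℕ i)
  ⊎ (toℕ j ≡ 0 × sucℕ (toℕ i) ≡ n)
  ⊎ (toℕ i ≡ 0 × sucℕ (toℕ j) ≡ n)

Cycle : ℕ → Graph
Cycle n = record { V = Fin n ; Adj = CycleAdj n }

-- The great shadow S(G): vertices inj₁ v (original) and inj₂ v (the shadow v').
-- v' is adjacent to v and to every G-neighbour of v; no edges among shadows.
ShadowAdj : (G : Graph) → V G ⊎ V G → V G ⊎ V G → Set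
ShadowAdj G (inj₁ u) (inj₁ v) = Adj G u v
ShadowAdj G (inj₁ u) (inj₂ v) = (u ≡ v) ⊎ Adj G v u
ShadowAdj G (inj₂ u) (inj₁ v) = (u ≡ v) ⊎ Adj G u v
ShadowAdj G (inj₂ u) (inj₂ v) = ⊥

GreatShadow : Graph → Graph
GreatShadow G = record { V = V G ⊎ V G ; Adj = ShadowAdj G }

Point : Set
Point = ℤ × ℤ

-- twice the signed area of triangle p q r
orient : Point → Point → Point → ℤ
orient (px , py) (qx , qy) (rx , ry) = (qx - px) * (ry - py) - (qy - py) * (rx - px)

OnSegment : Point → Point → Point → Set
OnSegment r@(rx , ry) p@(px , py) q@(qx , qy) =
  orient p q r ≡ 0ℤ ×
  (px ⊓ qx ≤ rx × rx ≤ px ⊔ qx) ×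
  (py ⊓ qy ≤ ry × ry ≤ py ⊔ qy)

ProperCross : Point → Point → Point → Point → Set
ProperCross a b c d =
  (orient a b c * orient a b d < 0ℤ) × (orient c d a * orient c d b < 0ℤ)

-- A straight-line planar drawing with integer coordinates:
-- distinct vertices get distinct points, no vertex lies on an edge not incident
-- to it, and edges with no common endpoint do not cross.
-- (Together these say edges meet only at common endpoints.)
record StraightLineEmbedding (G : Graph) : Set where
  field
    pos      : V G → Point
    injective : ∀ u v → pos u ≡ pos v → u ≡ v
    noVertexOnEdge : ∀ u v w → Adj G u v → w ≢ u → w ≢ v →
                     ¬ OnSegment (pos w) (pos u) (pos v)
    noCrossing : ∀ a b c d → Adj G a b → Adj G c d →
                 a ≢ c → a ≢ d → b ≢ c → b ≢ d →
                 ¬ ProperCross (pos a) (pos b) (pos c) (pos d)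

-- Planarity (for finite simple graphs; by Fáry's theorem and the existence of
-- grid drawings this is equivalent to the topological notion).
Planar : Graph → Set
Planar G = StraightLineEmbedding G

-- Write n = t + 4 with t even and draw the cycle as the boundary of a rectangle: v_2, …, v_{n-1}
-- along the bottom side, v_1 and v_0 at the top corners. Odd shadows go inside the rectangle and
-- even ones outside: the shadow of a bottom vertex sits just left of it, alternately below and
-- above the bottom side, s_1 inside near the top-left corner and s_0 outside near the top-right
-- one. Evenness of n is exactly what puts s_{n-1}, the shadow next to the right side, inside,
-- where it can reach v_0. Any two edges without a common endpoint are then separated by a
-- horizontal or vertical line, so they cannot cross properly, and every vertex off an edge lies
-- strictly outside the edge's bounding box or off its line. The conditions among the finitely many
-- corner pieces, whose coordinates are affine in the width 2t, are decided by evaluation.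
module Submission where

open import Defs
open import Data.Nat as ℕ using (ℕ; zero; suc; z≤n; s≤s; ⌊_/2⌋)
import Data.Nat.Properties as ℕP
open import Data.Nat.Divisibility using (_∣_; divides)
open import Data.Integer as ℤ using (ℤ; +_; -[1+_]; 0ℤ; -_; +≤+; +<+; -<+)
import Data.Integer.Properties as ℤP
open import Data.Integer.Tactic.RingSolver using (solve-∀)
open import Data.Bool using (T)
open import Data.Fin using (Fin; zero; suc; toℕ)
open import Data.Fin.Properties using (all?; _≟_; toℕ<n; toℕ-injective)
open import Data.Product using (_×_; _,_; proj₁; proj₂; swap)
open import Data.Sum as Sum using (_⊎_; inj₁; inj₂)
open import Data.Empty using (⊥; ⊥-elim)
open import Function using (_∘_)
open import Relation.Binary.PropositionalEquality
open import Relation.Binary.Definitions using (Decidable; tri<; tri≈; tri>)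
open import Relation.Nullary using (¬_; Dec; no; contraposition)
open import Relation.Nullary.Decidable using (toWitness; _×-dec_; _⊎-dec_)

module Orientation where
  open import Data.Integer using (_+_; _-_; _*_; _≤_; _<_)

  orient-swap : ∀ p q r → orient q p r ≡ - orient p q r
  orient-swap (px , py) (qx , qy) (rx , ry) = identity px py qx qy rx ry
    where
    identity : ∀ px py qx qy rx ry →
      (px - qx) * (ry - qy) - (py - qy) * (rx - qx) ≡ - ((qx - px) * (ry - py) - (qy - py) * (rx - px))
    identity = solve-∀

  orient-transpose : ∀ p q r → orient (swap p) (swap q) (swap r) ≡ - orient p q r
  orient-transpose (px , py) (qx , qy) (rx , ry) = identity px py qx qy rx ry
    where
    identity : ∀ px py qx qy rx ry →
      (qy - py) * (rx - px) - (qx - px) * (ry - py) ≡ - ((qx - px) * (ry - py) - (qy - py) * (rx - px))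
    identity = solve-∀

  orient-translate : ∀ d p q r →
    orient (proj₁ p + d , proj₂ p) (proj₁ q + d , proj₂ q) (proj₁ r + d , proj₂ r) ≡ orient p q r
  orient-translate d (px , py) (qx , qy) (rx , ry) = identity d px py qx qy rx ry
    where
    identity : ∀ d px py qx qy rx ry →
      (qx + d - (px + d)) * (ry - py) - (qy - py) * (rx + d - (px + d))
        ≡ (qx - px) * (ry - py) - (qy - py) * (rx - px)
    identity = solve-∀

  orient-exchange : ∀ a b c d → orient a b c + orient c d a ≡ orient a b d + orient c d b
  orient-exchange (ax , ay) (bx , by) (cx , cy) (dx , dy) = identity ax ay bx by cx cy dx dy
    where
    identity : ∀ ax ay bx by cx cy dx dy →
      (bx - ax) * (cy - ay) - (by - ay) * (cx - ax) + ((dx - cx) * (ay - cy) - (dy - cy) * (ax - cx))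
        ≡ (bx - ax) * (dy - ay) - (by - ay) * (dx - ax) + ((dx - cx) * (by - cy) - (dy - cy) * (bx - cx))
    identity = solve-∀

  orient-weighted : ∀ k a b c d →
    (k - proj₁ a) * orient c d b + (k - proj₁ b) * - orient c d a
      + (proj₁ c - k) * - orient a b d + (proj₁ d - k) * orient a b c ≡ 0ℤ
  orient-weighted k (ax , ay) (bx , by) (cx , cy) (dx , dy) = identity k ax ay bx by cx cy dx dy
    where
    identity : ∀ k ax ay bx by cx cy dx dy →
      (k - ax) * ((dx - cx) * (by - cy) - (dy - cy) * (bx - cx))
        + (k - bx) * - ((dx - cx) * (ay - cy) - (dy - cy) * (ax - cx))
        + (cx - k) * - ((bx - ax) * (dy - ay) - (by - ay) * (dx - ax))
        + (dx - k) * ((bx - ax) * (cy - ay) - (by - ay) * (cx - ax)) ≡ 0ℤ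
    identity = solve-∀

  orient-vertical : ∀ {a b c} → proj₁ a ≡ proj₁ c → proj₁ b ≡ proj₁ c → orient a b c ≡ 0ℤ
  orient-vertical {x , ay} {.x , by} {.x , cy} refl refl = identity x ay by cy
    where
    identity : ∀ x ay by cy → (x - x) * (cy - ay) - (by - ay) * (x - x) ≡ 0ℤ
    identity = solve-∀

  neg*neg : ∀ x y → - x * - y ≡ x * y
  neg*neg = solve-∀

  ProperCross-sym : ∀ {a b c d} → ProperCross a b c d → ProperCross c d a b
  ProperCross-sym (ab , cd) = cd , ab

  ProperCross-swapˡ : ∀ {a b c d} → ProperCross a b c d → ProperCross b a c d
  ProperCross-swapˡ {a} {b} {c} {d} (ab , cd) =
    subst (_< 0ℤ) (sym negated) ab , subst (_< 0ℤ) (ℤP.*-comm (orient c d a) (orient c d b)) cd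
    where
    negated : orient b a c * orient b a d ≡ orient a b c * orient a b d
    negated = trans (cong₂ _*_ (orient-swap a b c) (orient-swap a b d)) (neg*neg (orient a b c) (orient a b d))

  ProperCross-swapʳ : ∀ {a b c d} → ProperCross a b c d → ProperCross a b d c
  ProperCross-swapʳ {a} {b} {c} {d} =
    ProperCross-sym {d} {c} {a} {b} ∘ ProperCross-swapˡ {c} {d} {a} {b} ∘ ProperCross-sym {a} {b} {c} {d}

  ProperCross-transpose : ∀ {a b c d} → ProperCross a b c d → ProperCross (swap a) (swap b) (swap c) (swap d)
  ProperCross-transpose {a} {b} {c} {d} (ab , cd) =
    subst (_< 0ℤ) (sym (negated a b c d)) ab , subst (_< 0ℤ) (sym (negated c d a b)) cd
    where
    negated : ∀ a b c d →
      orient (swap a) (swap b) (swap c) * orient (swap a) (swap b) (swap d) ≡ orient a b c * orient a b d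
    negated a b c d =
      trans (cong₂ _*_ (orient-transpose a b c) (orient-transpose a b d)) (neg*neg (orient a b c) (orient a b d))

  OnSegment-sym : ∀ {r p q} → OnSegment r p q → OnSegment r q p
  OnSegment-sym {rx , ry} {px , py} {qx , qy} (collinear , (x₁ , x₂) , (y₁ , y₂)) =
    trans (orient-swap (px , py) (qx , qy) (rx , ry)) (cong -_ collinear) ,
    (subst (_≤ rx) (ℤP.⊓-comm px qx) x₁ , subst (rx ≤_) (ℤP.⊔-comm px qx) x₂) ,
    (subst (_≤ ry) (ℤP.⊓-comm py qy) y₁ , subst (ry ≤_) (ℤP.⊔-comm py qy) y₂)

  private
    opposite-signs : ∀ x y → x * y < 0ℤ → (0ℤ < x × y < 0ℤ) ⊎ (x < 0ℤ × 0ℤ < y)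
    opposite-signs (+ zero)  y         (+<+ ())
    opposite-signs x         (+ zero)  xy<0 = ⊥-elim (ℤP.<-irrefl refl (subst (_< 0ℤ) (ℤP.*-zeroʳ x) xy<0))
    opposite-signs (+ suc m) (+ suc n) (+<+ ())
    opposite-signs (+ suc m) -[1+ n ]  _    = inj₁ (+<+ (s≤s z≤n) , -<+)
    opposite-signs -[1+ m ]  (+ suc n) _    = inj₂ (-<+ , +<+ (s≤s z≤n))
    opposite-signs -[1+ m ]  -[1+ n ]  (+<+ ())

    *-nonneg-pos : ∀ {x y} → 0ℤ ≤ x → 0ℤ < y → 0ℤ ≤ x * y
    *-nonneg-pos {+ m} {+ n} _ _ = subst (0ℤ ≤_) (ℤP.pos-* m n) (+≤+ z≤n)

    *-pos-zero : ∀ x {y} → 0ℤ < y → x * y ≡ 0ℤ → x ≡ 0ℤ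
    *-pos-zero x 0<y xy≡0 with ℤP.i*j≡0⇒i≡0∨j≡0 x xy≡0
    ... | inj₁ x≡0 = x≡0
    ... | inj₂ refl = ⊥-elim (ℤP.<-irrefl refl 0<y)

    nonneg-sum-zero : ∀ x y → 0ℤ ≤ x → 0ℤ ≤ y → x + y ≡ 0ℤ → x ≡ 0ℤ × y ≡ 0ℤ
    nonneg-sum-zero x y 0≤x 0≤y x+y≡0 =
      x≡0 , trans (sym (ℤP.+-identityˡ y)) (subst (λ z → z + y ≡ 0ℤ) x≡0 x+y≡0)
      where
      x≡0 = ℤP.≤-antisym (subst (x ≤_) x+y≡0 (ℤP.i≤i+j x y {{ℤ.nonNegative 0≤y}})) 0≤x

    -- If also orient c d a > 0 > orient c d b, orient-exchange equates a positive and a negative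
    -- sum; otherwise orient-weighted is a vanishing sum of four non-negative terms, which puts
    -- a, b and c on the line x = k.
    crossing-oriented : ∀ {a b c d} k → proj₁ a ≤ k → proj₁ b ≤ k → k ≤ proj₁ c → k ≤ proj₁ d →
      ProperCross a b c d → 0ℤ < orient a b c → orient a b d < 0ℤ → ⊥
    crossing-oriented {a} {b} {c} {d} k ha hb hc hd (_ , cd<0) A>0 B<0
      with opposite-signs (orient c d a) (orient c d b) cd<0
    ... | inj₁ (C>0 , D<0) =
      ℤP.<-asym (ℤP.+-mono-< B<0 D<0) (subst (0ℤ <_) (orient-exchange a b c d) (ℤP.+-mono-< A>0 C>0))
    ... | inj₂ (C<0 , D>0) = ℤP.<-irrefl (sym A≡0) A>0
      where
      α = k - proj₁ a
      β = k - proj₁ b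
      γ = proj₁ c - k
      δ = proj₁ d - k
      A = orient a b c
      B = orient a b d
      C = orient c d a
      D = orient c d b
      t₁ = *-nonneg-pos {α} {D} (ℤP.i≤j⇒0≤j-i ha) D>0
      t₂ = *-nonneg-pos {β} { - C} (ℤP.i≤j⇒0≤j-i hb) (ℤP.neg-mono-< C<0)
      t₃ = *-nonneg-pos {γ} { - B} (ℤP.i≤j⇒0≤j-i hc) (ℤP.neg-mono-< B<0)
      t₄ = *-nonneg-pos {δ} {A} (ℤP.i≤j⇒0≤j-i hd) A>0
      sum₃ = nonneg-sum-zero (α * D + β * - C + γ * - B) (δ * A)
               (ℤP.+-mono-≤ (ℤP.+-mono-≤ t₁ t₂) t₃) t₄ (orient-weighted k a b c d)
      sum₂ = nonneg-sum-zero (α * D + β * - C) (γ * - B) (ℤP.+-mono-≤ t₁ t₂) t₃ (proj₁ sum₃)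
      sum₁ = nonneg-sum-zero (α * D) (β * - C) t₁ t₂ (proj₁ sum₂)
      a≡k = sym (ℤP.i-j≡0⇒i≡j k _ (*-pos-zero α D>0 (proj₁ sum₁)))
      b≡k = sym (ℤP.i-j≡0⇒i≡j k _ (*-pos-zero β (ℤP.neg-mono-< C<0) (proj₂ sum₁)))
      c≡k = ℤP.i-j≡0⇒i≡j _ k (*-pos-zero γ (ℤP.neg-mono-< B<0) (proj₂ sum₂))
      A≡0 = orient-vertical {a} {b} {c} (trans a≡k (sym c≡k)) (trans b≡k (sym c≡k))

  crossing-separatedˣ : ∀ {a b c d} k → proj₁ a ≤ k → proj₁ b ≤ k → k ≤ proj₁ c → k ≤ proj₁ d →
    ¬ ProperCross a b c d
  crossing-separatedˣ {a} {b} {c} {d} k ha hb hc hd pc@(ab<0 , _)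
    with opposite-signs (orient a b c) (orient a b d) ab<0
  ... | inj₁ (A>0 , B<0) = crossing-oriented {a} {b} {c} {d} k ha hb hc hd pc A>0 B<0
  ... | inj₂ (A<0 , B>0) =
    crossing-oriented {a} {b} {d} {c} k ha hb hd hc (ProperCross-swapʳ {a} {b} {c} {d} pc) B>0 A<0

  crossing-separatedʸ : ∀ {a b c d} k → proj₂ a ≤ k → proj₂ b ≤ k → k ≤ proj₂ c → k ≤ proj₂ d →
    ¬ ProperCross a b c d
  crossing-separatedʸ {a} {b} {c} {d} k ha hb hc hd =
    crossing-separatedˣ {swap a} {swap b} {swap c} {swap d} k ha hb hc hd
      ∘ ProperCross-transpose {a} {b} {c} {d}

open Orientation

module _ {G : Graph} {K : Set} (label : V G → K) (pos : K → Point) (Link : K → K → Set) where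

  straightLineEmbedding :
    (∀ u v → label u ≡ label v → u ≡ v) →
    (∀ p q → pos p ≡ pos q → p ≡ q) →
    (∀ {u v} → Adj G u v → Link (label u) (label v) ⊎ Link (label v) (label u)) →
    (∀ u {p q} → Link p q → label u ≢ p → label u ≢ q → ¬ OnSegment (pos (label u)) (pos p) (pos q)) →
    (∀ {p q r s} → Link p q → Link r s → p ≢ r → p ≢ s → q ≢ r → q ≢ s →
       ¬ ProperCross (pos p) (pos q) (pos r) (pos s)) →
    StraightLineEmbedding G
  straightLineEmbedding label-injective pos-injective link vertex-off links-apart = record
    { pos = at
    ; injective = λ u v same → label-injective u v (pos-injective (label u) (label v) same)
    ; noVertexOnEdge = noVertexOnEdge
    ; noCrossing = noCrossing
    }
    where
    at : V G → Point
    at u = pos (label u)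

    distinct : ∀ {u v} → u ≢ v → label u ≢ label v
    distinct u≢v same = u≢v (label-injective _ _ same)

    noVertexOnEdge : ∀ u v w → Adj G u v → w ≢ u → w ≢ v → ¬ OnSegment (at w) (at u) (at v)
    noVertexOnEdge u v w uv w≢u w≢v with link uv
    ... | inj₁ l = vertex-off w l (distinct w≢u) (distinct w≢v)
    ... | inj₂ l = vertex-off w l (distinct w≢v) (distinct w≢u) ∘ OnSegment-sym {at w} {at u} {at v}

    noCrossing : ∀ a b c d → Adj G a b → Adj G c d → a ≢ c → a ≢ d → b ≢ c → b ≢ d →
      ¬ ProperCross (at a) (at b) (at c) (at d)
    noCrossing a b c d ab cd a≢c a≢d b≢c b≢d with link ab | link cd
    ... | inj₁ l | inj₁ l′ = links-apart l l′ (distinct a≢c) (distinct a≢d) (distinct b≢c) (distinct b≢d)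
    ... | inj₁ l | inj₂ l′ = links-apart l l′ (distinct a≢d) (distinct a≢c) (distinct b≢d) (distinct b≢c)
                               ∘ ProperCross-swapʳ {at a} {at b} {at c} {at d}
    ... | inj₂ l | inj₁ l′ = links-apart l l′ (distinct b≢c) (distinct b≢d) (distinct a≢c) (distinct a≢d)
                               ∘ ProperCross-swapˡ {at a} {at b} {at c} {at d}
    ... | inj₂ l | inj₂ l′ = links-apart l l′ (distinct b≢d) (distinct b≢c) (distinct a≢d) (distinct a≢c)
                               ∘ ProperCross-swapˡ {at a} {at b} {at d} {at c}
                               ∘ ProperCross-swapʳ {at a} {at b} {at c} {at d}

module Lattice where
  open import Data.Nat using (_+_; _≤_; _<_; _≤ᵇ_)

  ⟨_,_⟩ : ℕ → ℕ → Point
  ⟨ x , y ⟩ = + x , + y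

  ⟨⟩-injective : ∀ {x y x′ y′} → ⟨ x , y ⟩ ≡ ⟨ x′ , y′ ⟩ → x ≡ x′ × y ≡ y′
  ⟨⟩-injective refl = refl , refl

  -- ProperCross and OnSegment unfold to integer arithmetic, from which Agda cannot infer the
  -- points; wrapped in these records the points stay rigid and are inferred by unification.
  record Crossing (a b c d : Point) : Set where
    constructor crossing
    field proper : ProperCross a b c d

  record Incident (r p q : Point) : Set where
    constructor incident
    field onSegment : OnSegment r p q

  Crossing-sym : ∀ {a b c d} → Crossing a b c d → Crossing c d a b
  Crossing-sym {a} {b} {c} {d} (crossing pc) = crossing (ProperCross-sym {a} {b} {c} {d} pc)

  Crossing-subst : ∀ {a b c d a′ b′ c′ d′} → a ≡ a′ → b ≡ b′ → c ≡ c′ → d ≡ d′ →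
    ¬ Crossing a′ b′ c′ d′ → ¬ Crossing a b c d
  Crossing-subst refl refl refl refl never = never

  Incident-subst : ∀ {r p q r′ p′ q′} → r ≡ r′ → p ≡ p′ → q ≡ q′ →
    ¬ Incident r′ p′ q′ → ¬ Incident r p q
  Incident-subst refl refl refl never = never

  module _ {ax ay bx by cx cy dx dy : ℕ} where

    apart-left : ∀ k → ax ≤ k → bx ≤ k → k ≤ cx → k ≤ dx →
      ¬ Crossing ⟨ ax , ay ⟩ ⟨ bx , by ⟩ ⟨ cx , cy ⟩ ⟨ dx , dy ⟩
    apart-left k ha hb hc hd (crossing pc) =
      crossing-separatedˣ {⟨ ax , ay ⟩} {⟨ bx , by ⟩} {⟨ cx , cy ⟩} {⟨ dx , dy ⟩}
        (+ k) (+≤+ ha) (+≤+ hb) (+≤+ hc) (+≤+ hd) pc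

    apart-right : ∀ k → cx ≤ k → dx ≤ k → k ≤ ax → k ≤ bx →
      ¬ Crossing ⟨ ax , ay ⟩ ⟨ bx , by ⟩ ⟨ cx , cy ⟩ ⟨ dx , dy ⟩
    apart-right k hc hd ha hb (crossing pc) =
      crossing-separatedˣ {⟨ cx , cy ⟩} {⟨ dx , dy ⟩} {⟨ ax , ay ⟩} {⟨ bx , by ⟩}
        (+ k) (+≤+ hc) (+≤+ hd) (+≤+ ha) (+≤+ hb)
        (ProperCross-sym {⟨ ax , ay ⟩} {⟨ bx , by ⟩} {⟨ cx , cy ⟩} {⟨ dx , dy ⟩} pc)

    apart-below : ∀ k → ay ≤ k → by ≤ k → k ≤ cy → k ≤ dy →
      ¬ Crossing ⟨ ax , ay ⟩ ⟨ bx , by ⟩ ⟨ cx , cy ⟩ ⟨ dx , dy ⟩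
    apart-below k ha hb hc hd (crossing pc) =
      crossing-separatedʸ {⟨ ax , ay ⟩} {⟨ bx , by ⟩} {⟨ cx , cy ⟩} {⟨ dx , dy ⟩}
        (+ k) (+≤+ ha) (+≤+ hb) (+≤+ hc) (+≤+ hd) pc

    apart-above : ∀ k → cy ≤ k → dy ≤ k → k ≤ ay → k ≤ by →
      ¬ Crossing ⟨ ax , ay ⟩ ⟨ bx , by ⟩ ⟨ cx , cy ⟩ ⟨ dx , dy ⟩
    apart-above k hc hd ha hb (crossing pc) =
      crossing-separatedʸ {⟨ cx , cy ⟩} {⟨ dx , dy ⟩} {⟨ ax , ay ⟩} {⟨ bx , by ⟩}
        (+ k) (+≤+ hc) (+≤+ hd) (+≤+ ha) (+≤+ hb)
        (ProperCross-sym {⟨ ax , ay ⟩} {⟨ bx , by ⟩} {⟨ cx , cy ⟩} {⟨ dx , dy ⟩} pc)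

  module _ {rx ry px py qx qy : ℕ} where

    off-left : rx < px → rx < qx → ¬ Incident ⟨ rx , ry ⟩ ⟨ px , py ⟩ ⟨ qx , qy ⟩
    off-left hp hq (incident (_ , (+≤+ h , _) , _)) = ℕP.<⇒≱ (ℕP.⊓-glb hp hq) h

    off-right : px < rx → qx < rx → ¬ Incident ⟨ rx , ry ⟩ ⟨ px , py ⟩ ⟨ qx , qy ⟩
    off-right hp hq (incident (_ , (_ , +≤+ h) , _)) = ℕP.<⇒≱ (ℕP.⊔-lub hp hq) h

    off-below : ry < py → ry < qy → ¬ Incident ⟨ rx , ry ⟩ ⟨ px , py ⟩ ⟨ qx , qy ⟩
    off-below hp hq (incident (_ , _ , (+≤+ h , _))) = ℕP.<⇒≱ (ℕP.⊓-glb hp hq) h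

    off-above : py < ry → qy < ry → ¬ Incident ⟨ rx , ry ⟩ ⟨ px , py ⟩ ⟨ qx , qy ⟩
    off-above hp hq (incident (_ , _ , (_ , +≤+ h))) = ℕP.<⇒≱ (ℕP.⊔-lub hp hq) h

  off-line : ∀ {r p q} → orient p q r ≢ 0ℤ → ¬ Incident r p q
  off-line noncollinear (incident (collinear , _)) = noncollinear collinear

  off-line-shifted : ∀ d rx ry px py qx qy → orient ⟨ px , py ⟩ ⟨ qx , qy ⟩ ⟨ rx , ry ⟩ ≢ 0ℤ →
    ¬ Incident ⟨ rx + d , ry ⟩ ⟨ px + d , py ⟩ ⟨ qx + d , qy ⟩
  off-line-shifted d rx ry px py qx qy noncollinear =
    off-line (noncollinear ∘ trans (sym shift-invariant))
    where
    shift-invariant :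
      orient ⟨ px + d , py ⟩ ⟨ qx + d , qy ⟩ ⟨ rx + d , ry ⟩ ≡ orient ⟨ px , py ⟩ ⟨ qx , qy ⟩ ⟨ rx , ry ⟩
    shift-invariant rewrite ℤP.pos-+ px d | ℤP.pos-+ qx d | ℤP.pos-+ rx d =
      orient-translate (+ d) (+ px , + py) (+ qx , + qy) (+ rx , + ry)

  -- The T argument is solved by η as soon as m ≤ᵇ n evaluates to true.
  ≤-compute : ∀ {m n} {_ : T (m ≤ᵇ n)} → m ≤ n
  ≤-compute {m} {n} {m≤ᵇn} = ℕP.≤ᵇ⇒≤ m n m≤ᵇn

  double : ℕ → ℕ
  double zero = zero
  double (suc n) = suc (suc (double n))

  double-mono-≤ : ∀ {i j} → i ≤ j → double i ≤ double j
  double-mono-≤ z≤n = z≤n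
  double-mono-≤ (s≤s i≤j) = s≤s (s≤s (double-mono-≤ i≤j))

  +-double-≤ : ∀ a b {i j} → a ≤ b → i ≤ j → a + double i ≤ b + double j
  +-double-≤ a b a≤b i≤j = ℕP.+-mono-≤ a≤b (double-mono-≤ i≤j)

  +-double-< : ∀ a b {i j} → i < j → a ≤ suc b → a + double i < b + double j
  +-double-< a b {i} {suc j} (s≤s i≤j) a≤1+b =
    ℕP.≤-trans (+-double-≤ (suc a) (suc (suc b)) (s≤s a≤1+b) i≤j)
      (ℕP.≤-reflexive (sym (trans (ℕP.+-suc b (suc (double j))) (cong suc (ℕP.+-suc b (double j))))))

open Lattice

-- Points of the corner pieces have abscissa c or c + w, where w = 2t is the width of the row, and a
-- fixed ordinate; the conditions among them are checked on these symbolic points for all w at once.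
module Symbolic where
  open import Data.Integer using (_+_; _-_; _*_; _≤_; _<_)

  data Abscissa : Set where
    fixed shifted : ℕ → Abscissa

  _at_ : Abscissa → ℕ → ℕ
  fixed c at w = c
  shifted c at w = c ℕ.+ w

  SymPoint : Set
  SymPoint = Abscissa × ℕ

  point : ℕ → SymPoint → Point
  point w (a , y) = ⟨ a at w , y ⟩

  succ : Abscissa → Abscissa
  succ (fixed c) = fixed (suc c)
  succ (shifted c) = shifted (suc c)

  _≼_ : Abscissa → Abscissa → Set
  fixed c   ≼ fixed d   = c ℕ.≤ d
  fixed c   ≼ shifted d = c ℕ.≤ d
  shifted c ≼ fixed d   = ⊥
  shifted c ≼ shifted d = c ℕ.≤ d

  _≺_ : Abscissa → Abscissa → Set
  a ≺ b = succ a ≼ b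

  _≼?_ : Decidable _≼_
  fixed c   ≼? fixed d   = c ℕP.≤? d
  fixed c   ≼? shifted d = c ℕP.≤? d
  shifted c ≼? fixed d   = no λ ()
  shifted c ≼? shifted d = c ℕP.≤? d

  ≼-sound : ∀ {a b} w → a ≼ b → a at w ℕ.≤ b at w
  ≼-sound {fixed c}   {fixed d}   w c≤d = c≤d
  ≼-sound {fixed c}   {shifted d} w c≤d = ℕP.≤-trans c≤d (ℕP.m≤m+n d w)
  ≼-sound {shifted c} {shifted d} w c≤d = ℕP.+-monoˡ-≤ w c≤d

  ≺-sound : ∀ {a b} w → a ≺ b → a at w ℕ.< b at w
  ≺-sound {fixed c}   = ≼-sound {fixed (suc c)}
  ≺-sound {shifted c} = ≼-sound {shifted (suc c)}

  base slope : Abscissa → ℤ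
  base (fixed c) = + c
  base (shifted c) = + c
  slope (fixed _) = 0ℤ
  slope (shifted _) = + 1

  abscissa-affine : ∀ a w → + (a at w) ≡ base a + slope a * + w
  abscissa-affine (fixed c) w = sym (ℤP.+-identityʳ (+ c))
  abscissa-affine (shifted c) w = trans (ℤP.pos-+ c w) (cong (_+_ (+ c)) (sym (ℤP.*-identityˡ (+ w))))

  orient₀ orient₁ : SymPoint → SymPoint → SymPoint → ℤ
  orient₀ (a , py) (b , qy) (c , ry) =
    (base b - base a) * (+ ry - + py) - (+ qy - + py) * (base c - base a)
  orient₁ (a , py) (b , qy) (c , ry) =
    (slope b - slope a) * (+ ry - + py) - (+ qy - + py) * (slope c - slope a)

  orient-symbolic : ∀ w p q r →
    orient (point w p) (point w q) (point w r) ≡ orient₀ p q r + orient₁ p q r * + w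
  orient-symbolic w (a , py) (b , qy) (c , ry)
    rewrite abscissa-affine a w | abscissa-affine b w | abscissa-affine c w =
    identity (base a) (slope a) (base b) (slope b) (base c) (slope c) (+ py) (+ qy) (+ ry) (+ w)
    where
    identity : ∀ ba sa bb sb bc sc ya yb yc w →
      (bb + sb * w - (ba + sa * w)) * (yc - ya) - (yb - ya) * (bc + sc * w - (ba + sa * w))
        ≡ (bb - ba) * (yc - ya) - (yb - ya) * (bc - ba) + ((sb - sa) * (yc - ya) - (yb - ya) * (sc - sa)) * w
    identity = solve-∀

  Definite : ℤ → ℤ → Set
  Definite α β = (0ℤ < α × 0ℤ ≤ β) ⊎ (α < 0ℤ × β ≤ 0ℤ)

  definite-nonzero : ∀ {α β} → Definite α β → ∀ w → α + β * + w ≢ 0ℤ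
  definite-nonzero (inj₁ (0<α , 0≤β)) w α+βw≡0 =
    ℤP.<-irrefl (sym α+βw≡0) (ℤP.+-mono-<-≤ 0<α (ℤP.*-monoʳ-≤-nonNeg (+ w) 0≤β))
  definite-nonzero (inj₂ (α<0 , β≤0)) w α+βw≡0 =
    ℤP.<-irrefl α+βw≡0 (ℤP.+-mono-<-≤ α<0 (ℤP.*-monoʳ-≤-nonNeg (+ w) β≤0))

  LeftOf Below : SymPoint → SymPoint → SymPoint → SymPoint → Set
  LeftOf (px , _) (qx , _) (rx , _) (sx , _) = px ≼ rx × px ≼ sx × qx ≼ rx × qx ≼ sx
  Below (_ , py) (_ , qy) (_ , ry) (_ , sy) = py ℕ.≤ ry × py ℕ.≤ sy × qy ℕ.≤ ry × qy ℕ.≤ sy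

  SegmentsApart : SymPoint → SymPoint → SymPoint → SymPoint → Set
  SegmentsApart p q r s = LeftOf p q r s ⊎ LeftOf r s p q ⊎ Below p q r s ⊎ Below r s p q

  OffSegment : SymPoint → SymPoint → SymPoint → Set
  OffSegment r@(rx , ry) p@(px , py) q@(qx , qy) =
    (rx ≺ px × rx ≺ qx) ⊎ (px ≺ rx × qx ≺ rx) ⊎ (ry ℕ.< py × ry ℕ.< qy) ⊎ (py ℕ.< ry × qy ℕ.< ry)
      ⊎ Definite (orient₀ p q r) (orient₁ p q r)

  segmentsApart? : ∀ p q r s → Dec (SegmentsApart p q r s)
  segmentsApart? p q r s = leftOf? p q r s ⊎-dec leftOf? r s p q ⊎-dec below? p q r s ⊎-dec below? r s p q
    where
    leftOf? : ∀ p q r s → Dec (LeftOf p q r s)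
    leftOf? (px , _) (qx , _) (rx , _) (sx , _) = px ≼? rx ×-dec px ≼? sx ×-dec qx ≼? rx ×-dec qx ≼? sx
    below? : ∀ p q r s → Dec (Below p q r s)
    below? (_ , py) (_ , qy) (_ , ry) (_ , sy) =
      py ℕP.≤? ry ×-dec py ℕP.≤? sy ×-dec qy ℕP.≤? ry ×-dec qy ℕP.≤? sy

  offSegment? : ∀ r p q → Dec (OffSegment r p q)
  offSegment? r@(rx , ry) p@(px , py) q@(qx , qy) =
    (succ rx ≼? px ×-dec succ rx ≼? qx) ⊎-dec (succ px ≼? rx ×-dec succ qx ≼? rx)
      ⊎-dec (ry ℕP.<? py ×-dec ry ℕP.<? qy) ⊎-dec (py ℕP.<? ry ×-dec qy ℕP.<? ry)
      ⊎-dec definite? (orient₀ p q r) (orient₁ p q r)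
    where
    definite? : ∀ α β → Dec (Definite α β)
    definite? α β = (0ℤ ℤP.<? α ×-dec 0ℤ ℤP.≤? β) ⊎-dec (α ℤP.<? 0ℤ ×-dec β ℤP.≤? 0ℤ)

  segmentsApart-sound : ∀ w {p q r s} → SegmentsApart p q r s →
    ¬ Crossing (point w p) (point w q) (point w r) (point w s)
  segmentsApart-sound w {px , _} {qx , _} (inj₁ (pr , ps , qr , qs)) =
    apart-left (px at w ℕ.⊔ qx at w) (ℕP.m≤m⊔n _ _) (ℕP.m≤n⊔m _ _)
      (ℕP.⊔-lub (≼-sound w pr) (≼-sound w qr)) (ℕP.⊔-lub (≼-sound w ps) (≼-sound w qs))
  segmentsApart-sound w {r = rx , _} {sx , _} (inj₂ (inj₁ (rp , rq , sp , sq))) =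
    apart-right (rx at w ℕ.⊔ sx at w) (ℕP.m≤m⊔n _ _) (ℕP.m≤n⊔m _ _)
      (ℕP.⊔-lub (≼-sound w rp) (≼-sound w sp)) (ℕP.⊔-lub (≼-sound w rq) (≼-sound w sq))
  segmentsApart-sound w {_ , py} {_ , qy} (inj₂ (inj₂ (inj₁ (pr , ps , qr , qs)))) =
    apart-below (py ℕ.⊔ qy) (ℕP.m≤m⊔n _ _) (ℕP.m≤n⊔m _ _) (ℕP.⊔-lub pr qr) (ℕP.⊔-lub ps qs)
  segmentsApart-sound w {r = _ , ry} {_ , sy} (inj₂ (inj₂ (inj₂ (rp , rq , sp , sq)))) =
    apart-above (ry ℕ.⊔ sy) (ℕP.m≤m⊔n _ _) (ℕP.m≤n⊔m _ _) (ℕP.⊔-lub rp sp) (ℕP.⊔-lub rq sq)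

  offSegment-sound : ∀ w {r p q} → OffSegment r p q → ¬ Incident (point w r) (point w p) (point w q)
  offSegment-sound w (inj₁ (rp , rq)) = off-left (≺-sound w rp) (≺-sound w rq)
  offSegment-sound w (inj₂ (inj₁ (pr , qr))) = off-right (≺-sound w pr) (≺-sound w qr)
  offSegment-sound w (inj₂ (inj₂ (inj₁ (rp , rq)))) = off-below rp rq
  offSegment-sound w (inj₂ (inj₂ (inj₂ (inj₁ (pr , qr))))) = off-above pr qr
  offSegment-sound w {r} {p} {q} (inj₂ (inj₂ (inj₂ (inj₂ definite)))) =
    off-line (λ collinear → definite-nonzero definite w (trans (sym (orient-symbolic w p q r)) collinear))

open Symbolic

open import Data.Nat using (_+_; _*_; _≤_; _<_)

data Kind : Set where
  v s : ℕ → Kind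

side : ℕ → ℕ
side zero = 0
side (suc zero) = 2
side (suc (suc j)) = side j

side-alternates : ∀ j → (side j ≡ 0 × side (suc j) ≡ 2) ⊎ (side j ≡ 2 × side (suc j) ≡ 0)
side-alternates zero = inj₁ (refl , refl)
side-alternates (suc zero) = inj₂ (refl , refl)
side-alternates (suc (suc j)) = side-alternates j

side≤2 : ∀ j → side j ≤ 2
side≤2 zero = z≤n
side≤2 (suc zero) = ℕP.≤-refl
side≤2 (suc (suc j)) = side≤2 j

side< : ∀ j {y} → 3 ≤ y → side j < y
side< j = ℕP.<-≤-trans (s≤s (side≤2 j))

side-flips : ∀ j → side j ≢ side (suc j)
side-flips j with side-alternates j
... | inj₁ (e₀ , e₂) rewrite e₀ | e₂ = λ ()
... | inj₂ (e₂ , e₀) rewrite e₂ | e₀ = λ ()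

same-side-gap : ∀ {c c′} → c < c′ → side c ≡ side c′ → 2 + c ≤ c′
same-side-gap {c} c<c′ level = ℕP.≤∧≢⇒< c<c′ λ { refl → side-flips c level }

half-double : ∀ j → ⌊ double j /2⌋ ≡ j
half-double zero = refl
half-double (suc j) = cong suc (half-double j)

data Near : ℕ → ℕ → Set where
  same : ∀ {c} → Near c c
  next : ∀ {c} → Near c (suc c)
  prev : ∀ {c} → Near (suc c) c

near-window : ∀ {c j} → Near c j → 2 + double c ≤ 4 + double j × 4 + double j ≤ 6 + double c
near-window {c} same =
  ℕP.+-monoˡ-≤ (double c) (≤-compute {2} {4}) , ℕP.+-monoˡ-≤ (double c) (≤-compute {4} {6})
near-window {c} next = ℕP.+-monoˡ-≤ (double c) (≤-compute {2} {6}) , ℕP.≤-refl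
near-window {j = j} prev = ℕP.≤-refl , ℕP.+-monoˡ-≤ (double j) (≤-compute {4} {8})

-- The vertices near the corners (VL and SL are v_{n-1} and s_{n-1}) and the eleven edges at v_0, v_1,
-- s_0, s_1 are coded by Fin, so that all? decides the checks over all of them.
CapVertex : Set
CapVertex = Fin 8

pattern V0 = zero
pattern V1 = suc zero
pattern S0 = suc (suc zero)
pattern S1 = suc (suc (suc zero))
pattern V2 = suc (suc (suc (suc zero)))
pattern S2 = suc (suc (suc (suc (suc zero))))
pattern VL = suc (suc (suc (suc (suc (suc zero)))))
pattern SL = suc (suc (suc (suc (suc (suc (suc zero))))))

CapEdge : Set
CapEdge = Fin 11

pattern V0V1 = zero
pattern S0V0 = suc zero
pattern S0V1 = suc (suc zero)
pattern S0VL = suc (suc (suc zero))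
pattern S1V0 = suc (suc (suc (suc zero)))
pattern S1V1 = suc (suc (suc (suc (suc zero))))
pattern S1V2 = suc (suc (suc (suc (suc (suc zero)))))
pattern V1V2 = suc (suc (suc (suc (suc (suc (suc zero))))))
pattern VLV0 = suc (suc (suc (suc (suc (suc (suc (suc zero)))))))
pattern S2V1 = suc (suc (suc (suc (suc (suc (suc (suc (suc zero))))))))
pattern SLV0 = suc (suc (suc (suc (suc (suc (suc (suc (suc (suc zero)))))))))

capEnds : CapEdge → CapVertex × CapVertex
capEnds V0V1 = V0 , V1
capEnds S0V0 = S0 , V0
capEnds S0V1 = S0 , V1
capEnds S0VL = S0 , VL
capEnds S1V0 = S1 , V0
capEnds S1V1 = S1 , V1
capEnds S1V2 = S1 , V2
capEnds V1V2 = V1 , V2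
capEnds VLV0 = VL , V0
capEnds S2V1 = S2 , V1
capEnds SLV0 = SL , V0

capPoint : CapVertex → SymPoint
capPoint V0 = shifted 6 , 5
capPoint V1 = fixed 4 , 5
capPoint S0 = shifted 7 , 6
capPoint S1 = fixed 5 , 4
capPoint V2 = fixed 4 , 1
capPoint S2 = fixed 3 , 0
capPoint VL = shifted 6 , 1
capPoint SL = shifted 5 , 2

EndsApart : CapVertex × CapVertex → CapVertex × CapVertex → Set
EndsApart (a , b) (c , d) =
  (a ≡ c ⊎ a ≡ d ⊎ b ≡ c ⊎ b ≡ d) ⊎ SegmentsApart (capPoint a) (capPoint b) (capPoint c) (capPoint d)

OffEnds : CapVertex → CapVertex × CapVertex → Set
OffEnds u (p , q) = u ≡ p ⊎ u ≡ q ⊎ OffSegment (capPoint u) (capPoint p) (capPoint q)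

cap-edges-apart : ∀ e f → EndsApart (capEnds e) (capEnds f)
cap-edges-apart = toWitness {a? = all? λ e → all? λ f → endsApart? (capEnds e) (capEnds f)} _
  where
  endsApart? : ∀ e f → Dec (EndsApart e f)
  endsApart? (a , b) (c , d) =
    (a ≟ c ⊎-dec a ≟ d ⊎-dec b ≟ c ⊎-dec b ≟ d)
      ⊎-dec segmentsApart? (capPoint a) (capPoint b) (capPoint c) (capPoint d)

cap-vertices-off : ∀ u e → OffEnds u (capEnds e)
cap-vertices-off = toWitness {a? = all? λ u → all? λ e → offEnds? u (capEnds e)} _
  where
  offEnds? : ∀ u e → Dec (OffEnds u e)
  offEnds? u (p , q) = u ≟ p ⊎-dec u ≟ q ⊎-dec offSegment? (capPoint u) (capPoint p) (capPoint q)

CycleNeighbours : ℕ → ℕ → ℕ → Set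
CycleNeighbours n a b = (suc a ≡ b) ⊎ (suc b ≡ a) ⊎ (b ≡ 0 × suc a ≡ n) ⊎ (a ≡ 0 × suc b ≡ n)

-- The parameter says that
-- s_{n-1} lies above the row; it is the only use of n being even.
module Drawing (t : ℕ) (last-shadow-above : side (suc t) ≡ 2) where

  grid : Kind → ℕ × ℕ
  grid (v 0) = 6 + double t , 5
  grid (v 1) = 4 , 5
  grid (v (suc (suc j))) = 4 + double j , 1
  grid (s 0) = 7 + double t , 6
  grid (s 1) = 5 , 4
  grid (s (suc (suc j))) = 3 + double j , side j

  pos : Kind → Point
  pos u = ⟨ proj₁ (grid u) , proj₂ (grid u) ⟩

  private
    -- The ordinate is matched first: matching on a symbolic abscissa would block evaluation.
    decode-at : ℕ → ℕ → Kind
    decode-at 5 4 = v 1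
    decode-at 5 _ = v 0
    decode-at 6 _ = s 0
    decode-at 4 _ = s 1
    decode-at 1 x = v ⌊ x /2⌋
    decode-at _ x = s ⌊ suc x /2⌋

    decode-grid : ∀ u → decode-at (proj₂ (grid u)) (proj₁ (grid u)) ≡ u
    decode-grid (v 0) = refl
    decode-grid (v 1) = refl
    decode-grid (v (suc (suc j))) = cong (λ i → v (2 + i)) (half-double j)
    decode-grid (s 0) = refl
    decode-grid (s 1) = refl
    decode-grid (s (suc (suc j))) with side-alternates j
    ... | inj₁ (below , _) rewrite below = cong (λ i → s (2 + i)) (half-double j)
    ... | inj₂ (above , _) rewrite above = cong (λ i → s (2 + i)) (half-double j)

  pos-injective : ∀ u u′ → pos u ≡ pos u′ → u ≡ u′
  pos-injective u u′ same-point = begin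
    u                                                ≡⟨ decode-grid u ⟨
    decode-at (proj₂ (grid u)) (proj₁ (grid u))     ≡⟨ cong₂ decode-at (proj₂ same-grid) (proj₁ same-grid) ⟩
    decode-at (proj₂ (grid u′)) (proj₁ (grid u′))   ≡⟨ decode-grid u′ ⟩
    u′                                               ∎
    where
    open ≡-Reasoning
    same-grid = ⟨⟩-injective same-point

  capKind : CapVertex → Kind
  capKind V0 = v 0
  capKind V1 = v 1
  capKind S0 = s 0
  capKind S1 = s 1
  capKind V2 = v 2
  capKind S2 = s 2
  capKind VL = v (3 + t)
  capKind SL = s (3 + t)

  capKind-pos : ∀ u → pos (capKind u) ≡ point (double t) (capPoint u)
  capKind-pos V0 = refl
  capKind-pos V1 = refl
  capKind-pos S0 = refl
  capKind-pos S1 = refl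
  capKind-pos V2 = refl
  capKind-pos S2 = refl
  capKind-pos VL = refl
  capKind-pos SL = cong ⟨ 5 + double t ,_⟩ last-shadow-above

  data Link : Kind → Kind → Set where
    cap   : ∀ e → Link (capKind (proj₁ (capEnds e))) (capKind (proj₂ (capEnds e)))
    path  : ∀ {j} → j ≤ t → Link (v (2 + j)) (v (3 + j))
    spoke : ∀ {c j} → Near c j → c ≤ suc t → j ≤ suc t → Link (s (2 + c)) (v (2 + j))

  index : Kind → ℕ
  index (v i) = i
  index (s i) = i

  Valid : Kind → Set
  Valid u = index u < 4 + t

  caps-apart : ∀ {a b c d} → EndsApart (a , b) (c , d) →
    capKind a ≢ capKind c → capKind a ≢ capKind d → capKind b ≢ capKind c → capKind b ≢ capKind d →
    ¬ Crossing (pos (capKind a)) (pos (capKind b)) (pos (capKind c)) (pos (capKind d))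
  caps-apart (inj₁ (inj₁ refl)) a≢c _ _ _ = ⊥-elim (a≢c refl)
  caps-apart (inj₁ (inj₂ (inj₁ refl))) _ a≢d _ _ = ⊥-elim (a≢d refl)
  caps-apart (inj₁ (inj₂ (inj₂ (inj₁ refl)))) _ _ b≢c _ = ⊥-elim (b≢c refl)
  caps-apart (inj₁ (inj₂ (inj₂ (inj₂ refl)))) _ _ _ b≢d = ⊥-elim (b≢d refl)
  caps-apart {a} {b} {c} {d} (inj₂ apart) _ _ _ _ =
    Crossing-subst (capKind-pos a) (capKind-pos b) (capKind-pos c) (capKind-pos d)
      (segmentsApart-sound (double t) apart)

  cap-vertex-off : ∀ {u a b} → OffEnds u (a , b) → capKind u ≢ capKind a → capKind u ≢ capKind b →
    ¬ Incident (pos (capKind u)) (pos (capKind a)) (pos (capKind b))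
  cap-vertex-off (inj₁ refl) u≢a _ = ⊥-elim (u≢a refl)
  cap-vertex-off (inj₂ (inj₁ refl)) _ u≢b = ⊥-elim (u≢b refl)
  cap-vertex-off {u} {a} {b} (inj₂ (inj₂ off)) _ _ =
    Incident-subst (capKind-pos u) (capKind-pos a) (capKind-pos b) (offSegment-sound (double t) off)

  paths-apart : ∀ {i j} → ¬ Crossing (pos (v (2 + i))) (pos (v (3 + i))) (pos (v (2 + j))) (pos (v (3 + j)))
  paths-apart = apart-below 1 ℕP.≤-refl ℕP.≤-refl ℕP.≤-refl ℕP.≤-refl

  path-spoke-apart : ∀ {i c j} →
    ¬ Crossing (pos (v (2 + i))) (pos (v (3 + i))) (pos (s (2 + c))) (pos (v (2 + j)))
  path-spoke-apart {c = c} with side-alternates c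
  ... | inj₁ (below , _) rewrite below = apart-above 1 z≤n ℕP.≤-refl ℕP.≤-refl ℕP.≤-refl
  ... | inj₂ (above , _) rewrite above = apart-below 1 ℕP.≤-refl ℕP.≤-refl ≤-compute ℕP.≤-refl

  spokes-apart-same-side : ∀ {c c′ j j′} → Near c j → Near c′ j′ → c < c′ → side c ≡ side c′ →
    ¬ Crossing (pos (s (2 + c))) (pos (v (2 + j))) (pos (s (2 + c′))) (pos (v (2 + j′)))
  spokes-apart-same-side {c} {c′} near near′ c<c′ level =
    apart-left (6 + double c) (+-double-≤ 3 6 ≤-compute ℕP.≤-refl) (proj₂ (near-window near))
      (ℕP.≤-trans (ℕP.n≤1+n _) (+-double-≤ 3 3 ℕP.≤-refl gap))
      (ℕP.≤-trans (+-double-≤ 2 2 ℕP.≤-refl gap) (proj₁ (near-window near′)))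
    where
    gap = same-side-gap c<c′ level

  spokes-apart : ∀ {c c′ j j′} → Near c j → Near c′ j′ → c ≢ c′ →
    ¬ Crossing (pos (s (2 + c))) (pos (v (2 + j))) (pos (s (2 + c′))) (pos (v (2 + j′)))
  spokes-apart {c} {c′} near near′ c≢c′ with side-alternates c | side-alternates c′ | ℕP.<-cmp c c′
  ... | _ | _ | tri≈ _ c≡c′ _ = ⊥-elim (c≢c′ c≡c′)
  ... | inj₁ (below , _) | inj₂ (above′ , _) | _ rewrite below | above′ =
    apart-below 1 z≤n ℕP.≤-refl ≤-compute ℕP.≤-refl
  ... | inj₂ (above , _) | inj₁ (below′ , _) | _ rewrite above | below′ =
    apart-above 1 z≤n ℕP.≤-refl ≤-compute ℕP.≤-refl
  ... | inj₁ (below , _) | inj₁ (below′ , _) | tri< c<c′ _ _ =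
    spokes-apart-same-side near near′ c<c′ (trans below (sym below′))
  ... | inj₁ (below , _) | inj₁ (below′ , _) | tri> _ _ c′<c =
    contraposition Crossing-sym (spokes-apart-same-side near′ near c′<c (trans below′ (sym below)))
  ... | inj₂ (above , _) | inj₂ (above′ , _) | tri< c<c′ _ _ =
    spokes-apart-same-side near near′ c<c′ (trans above (sym above′))
  ... | inj₂ (above , _) | inj₂ (above′ , _) | tri> _ _ c′<c =
    contraposition Crossing-sym (spokes-apart-same-side near′ near c′<c (trans above′ (sym above)))

  cap-path-apart : ∀ {j} e → j ≤ t →
    let a = capKind (proj₁ (capEnds e)) ; b = capKind (proj₂ (capEnds e)) in
    ¬ Crossing (pos a) (pos b) (pos (v (2 + j))) (pos (v (3 + j)))
  cap-path-apart V0V1 _ = apart-above 1 ℕP.≤-refl ℕP.≤-refl ≤-compute ≤-compute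
  cap-path-apart S0V0 _ = apart-above 1 ℕP.≤-refl ℕP.≤-refl ≤-compute ≤-compute
  cap-path-apart S0V1 _ = apart-above 1 ℕP.≤-refl ℕP.≤-refl ≤-compute ≤-compute
  cap-path-apart S1V0 _ = apart-above 1 ℕP.≤-refl ℕP.≤-refl ≤-compute ≤-compute
  cap-path-apart S1V1 _ = apart-above 1 ℕP.≤-refl ℕP.≤-refl ≤-compute ≤-compute
  cap-path-apart S1V2 _ = apart-above 1 ℕP.≤-refl ℕP.≤-refl ≤-compute ≤-compute
  cap-path-apart V1V2 _ = apart-above 1 ℕP.≤-refl ℕP.≤-refl ≤-compute ≤-compute
  cap-path-apart VLV0 _ = apart-above 1 ℕP.≤-refl ℕP.≤-refl ≤-compute ≤-compute
  cap-path-apart SLV0 _ rewrite last-shadow-above = apart-above 1 ℕP.≤-refl ℕP.≤-refl ≤-compute ≤-compute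
  cap-path-apart S0VL j≤t =
    apart-right (6 + double t) (+-double-≤ 4 6 ≤-compute j≤t) (+-double-≤ 6 6 ℕP.≤-refl j≤t)
      (ℕP.n≤1+n _) ℕP.≤-refl
  cap-path-apart S2V1 _ = apart-left 4 ≤-compute ℕP.≤-refl (ℕP.m≤m+n 4 _) (ℕP.m≤m+n 4 _)

  cap-spoke-apart : ∀ {c j} e → Near c j → c ≤ suc t → j ≤ suc t →
    let a = capKind (proj₁ (capEnds e)) ; b = capKind (proj₂ (capEnds e)) in
    a ≢ s (2 + c) → b ≢ v (2 + j) →
    ¬ Crossing (pos a) (pos b) (pos (s (2 + c))) (pos (v (2 + j)))
  cap-spoke-apart {c} V0V1 _ _ _ _ _ = apart-above 2 (side≤2 c) ≤-compute ≤-compute ≤-compute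
  cap-spoke-apart {c} S0V0 _ _ _ _ _ = apart-above 2 (side≤2 c) ≤-compute ≤-compute ≤-compute
  cap-spoke-apart {c} S0V1 _ _ _ _ _ = apart-above 2 (side≤2 c) ≤-compute ≤-compute ≤-compute
  cap-spoke-apart {c} S1V0 _ _ _ _ _ = apart-above 2 (side≤2 c) ≤-compute ≤-compute ≤-compute
  cap-spoke-apart {c} S1V1 _ _ _ _ _ = apart-above 2 (side≤2 c) ≤-compute ≤-compute ≤-compute
  cap-spoke-apart {c} SLV0 _ _ _ _ _ rewrite last-shadow-above =
    apart-above 2 (side≤2 c) ≤-compute ℕP.≤-refl ≤-compute
  cap-spoke-apart S0VL _ c≤ j≤ _ _ =
    apart-right (6 + double t) (+-double-≤ 3 4 ≤-compute c≤) (+-double-≤ 4 4 ℕP.≤-refl j≤)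
      (ℕP.n≤1+n _) ℕP.≤-refl
  cap-spoke-apart VLV0 _ c≤ j≤ _ _ =
    apart-right (6 + double t) (+-double-≤ 3 4 ≤-compute c≤) (+-double-≤ 4 4 ℕP.≤-refl j≤)
      ℕP.≤-refl ℕP.≤-refl
  cap-spoke-apart {zero} S1V2 same _ _ _ b≢d = ⊥-elim (b≢d refl)
  cap-spoke-apart {zero} S1V2 next _ _ _ _ = apart-above 1 z≤n ℕP.≤-refl ≤-compute ℕP.≤-refl
  cap-spoke-apart {suc zero} {zero} S1V2 prev _ _ _ b≢d = ⊥-elim (b≢d refl)
  cap-spoke-apart {suc c} {suc j} S1V2 _ _ _ _ _ = apart-left 5 ℕP.≤-refl ≤-compute (ℕP.m≤m+n 5 _) (ℕP.m≤m+n 5 _)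
  cap-spoke-apart {zero} V1V2 same _ _ _ b≢d = ⊥-elim (b≢d refl)
  cap-spoke-apart {zero} V1V2 next _ _ _ _ = apart-above 1 z≤n ℕP.≤-refl ≤-compute ℕP.≤-refl
  cap-spoke-apart {suc c} V1V2 _ _ _ _ _ = apart-left 4 ℕP.≤-refl ℕP.≤-refl (ℕP.m≤m+n 4 _) (ℕP.m≤m+n 4 _)
  cap-spoke-apart {zero} S2V1 _ _ _ a≢c _ = ⊥-elim (a≢c refl)
  cap-spoke-apart {suc c} S2V1 _ _ _ _ _ = apart-left 4 ≤-compute ℕP.≤-refl (ℕP.m≤m+n 4 _) (ℕP.m≤m+n 4 _)

  links-apart : ∀ {a b c d} → Link a b → Link c d → a ≢ c → a ≢ d → b ≢ c → b ≢ d →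
    ¬ Crossing (pos a) (pos b) (pos c) (pos d)
  links-apart (cap e) (cap f) = caps-apart (cap-edges-apart e f)
  links-apart (cap e) (path j≤t) _ _ _ _ = cap-path-apart e j≤t
  links-apart (cap e) (spoke near c≤ j≤) a≢c _ _ b≢d = cap-spoke-apart e near c≤ j≤ a≢c b≢d
  links-apart (path j≤t) (cap f) _ _ _ _ = contraposition Crossing-sym (cap-path-apart f j≤t)
  links-apart (path _) (path _) _ _ _ _ = paths-apart
  links-apart (path _) (spoke _ _ _) _ _ _ _ = path-spoke-apart
  links-apart (spoke near c≤ j≤) (cap f) a≢c _ _ b≢d =
    contraposition Crossing-sym (cap-spoke-apart f near c≤ j≤ (a≢c ∘ sym) (b≢d ∘ sym))
  links-apart (spoke _ _ _) (path _) _ _ _ _ = contraposition Crossing-sym path-spoke-apart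
  links-apart (spoke near _ _) (spoke near′ _ _) a≢c _ _ _ =
    spokes-apart near near′ (a≢c ∘ cong (λ c → s (2 + c)))

  vertex-off-path : ∀ {u j} → u ≢ v (2 + j) → u ≢ v (3 + j) →
    ¬ Incident (pos u) (pos (v (2 + j))) (pos (v (3 + j)))
  vertex-off-path {v 0} _ _ = off-above ≤-compute ≤-compute
  vertex-off-path {v 1} _ _ = off-above ≤-compute ≤-compute
  vertex-off-path {s 0} _ _ = off-above ≤-compute ≤-compute
  vertex-off-path {s 1} _ _ = off-above ≤-compute ≤-compute
  vertex-off-path {v (suc (suc i))} {j} u≢p u≢q with ℕP.<-cmp i j
  ... | tri< i<j _ _ = off-left (+-double-< 4 4 i<j ≤-compute) (+-double-< 4 6 i<j ≤-compute)
  ... | tri≈ _ refl _ = ⊥-elim (u≢p refl)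
  ... | tri> _ _ j<i with ℕP.m≤n⇒m<n∨m≡n j<i
  ...   | inj₁ 1+j<i = off-right (+-double-< 4 4 j<i ≤-compute) (+-double-< 4 4 1+j<i ≤-compute)
  ...   | inj₂ refl = ⊥-elim (u≢q refl)
  vertex-off-path {s (suc (suc i))} _ _ with side-alternates i
  ... | inj₁ (below , _) rewrite below = off-below ≤-compute ≤-compute
  ... | inj₂ (above , _) rewrite above = off-above ≤-compute ≤-compute

  row-vertex-off-spoke : ∀ {i c j} → Near c j → v (2 + i) ≢ s (2 + c) → v (2 + i) ≢ v (2 + j) →
    ¬ Incident (pos (v (2 + i))) (pos (s (2 + c))) (pos (v (2 + j)))
  row-vertex-off-spoke {i} {c} same _ u≢q with ℕP.<-cmp i c
  ... | tri< i<c _ _ = off-left (+-double-< 4 3 i<c ≤-compute) (+-double-< 4 4 i<c ≤-compute)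
  ... | tri≈ _ refl _ = ⊥-elim (u≢q refl)
  ... | tri> _ _ c<i = off-right (+-double-< 3 4 c<i ≤-compute) (+-double-< 4 4 c<i ≤-compute)
  row-vertex-off-spoke {i} {c} next _ u≢q with ℕP.<-cmp i c
  ... | tri< i<c _ _ = off-left (+-double-< 4 3 i<c ≤-compute) (+-double-< 4 6 i<c ≤-compute)
  ... | tri≈ _ refl _ with side-alternates c
  ...   | inj₁ (below , _) rewrite below = off-line-shifted (double c) 4 1 3 0 6 1 (λ ())
  ...   | inj₂ (above , _) rewrite above = off-line-shifted (double c) 4 1 3 2 6 1 (λ ())
  row-vertex-off-spoke {i} {c} next _ u≢q | tri> _ _ c<i with ℕP.m≤n⇒m<n∨m≡n c<i
  ... | inj₁ 1+c<i = off-right (+-double-< 3 4 c<i ≤-compute) (+-double-< 4 4 1+c<i ≤-compute)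
  ... | inj₂ refl = ⊥-elim (u≢q refl)
  row-vertex-off-spoke {i} {j = c} prev _ u≢q with ℕP.<-cmp i c
  ... | tri< i<c _ _ = off-left (+-double-< 4 5 i<c ≤-compute) (+-double-< 4 4 i<c ≤-compute)
  ... | tri≈ _ refl _ = ⊥-elim (u≢q refl)
  ... | tri> _ _ c<i = off-right (+-double-< 5 4 c<i ≤-compute) (+-double-< 4 4 c<i ≤-compute)

  shadow-off-spoke : ∀ {i c j} → Near c j → s (2 + i) ≢ s (2 + c) → s (2 + i) ≢ v (2 + j) →
    ¬ Incident (pos (s (2 + i))) (pos (s (2 + c))) (pos (v (2 + j)))
  shadow-off-spoke {i} {c} same u≢p _ with ℕP.<-cmp i c
  ... | tri< i<c _ _ = off-left (+-double-< 3 3 i<c ≤-compute) (+-double-< 3 4 i<c ≤-compute)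
  ... | tri≈ _ refl _ = ⊥-elim (u≢p refl)
  ... | tri> _ _ c<i = off-right (+-double-< 3 3 c<i ≤-compute) (+-double-< 4 3 c<i ≤-compute)
  shadow-off-spoke {i} {c} next u≢p _ with ℕP.<-cmp i c
  ... | tri< i<c _ _ = off-left (+-double-< 3 3 i<c ≤-compute) (+-double-< 3 6 i<c ≤-compute)
  ... | tri≈ _ refl _ = ⊥-elim (u≢p refl)
  ... | tri> _ _ c<i with ℕP.m≤n⇒m<n∨m≡n c<i
  ...   | inj₁ 1+c<i = off-right (+-double-< 3 3 c<i ≤-compute) (+-double-< 4 3 1+c<i ≤-compute)
  ...   | inj₂ refl with side-alternates c
  ...     | inj₁ (below , above′) rewrite below | above′ = off-above ≤-compute ≤-compute
  ...     | inj₂ (above , below′) rewrite above | below′ = off-below ≤-compute ≤-compute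
  shadow-off-spoke {i} {j = c} prev u≢p _ with ℕP.<-cmp i (suc c)
  ... | tri< i<1+c _ _ = off-left (+-double-< 3 3 i<1+c ≤-compute) (+-double-< 3 2 i<1+c ≤-compute)
  ... | tri≈ _ refl _ = ⊥-elim (u≢p refl)
  ... | tri> _ _ 1+c<i =
    off-right (+-double-< 3 3 1+c<i ≤-compute) (+-double-< 4 3 (ℕP.<-trans (ℕP.n<1+n c) 1+c<i) ≤-compute)

  vertex-off-spoke : ∀ {u c j} → Near c j → u ≢ s (2 + c) → u ≢ v (2 + j) →
    ¬ Incident (pos u) (pos (s (2 + c))) (pos (v (2 + j)))
  vertex-off-spoke {v 0} {c} _ _ _ = off-above (side< c ≤-compute) ≤-compute
  vertex-off-spoke {v 1} {c} _ _ _ = off-above (side< c ≤-compute) ≤-compute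
  vertex-off-spoke {s 0} {c} _ _ _ = off-above (side< c ≤-compute) ≤-compute
  vertex-off-spoke {s 1} {c} _ _ _ = off-above (side< c ≤-compute) ≤-compute
  vertex-off-spoke {v (suc (suc i))} near = row-vertex-off-spoke near
  vertex-off-spoke {s (suc (suc i))} near = shadow-off-spoke near

  row-vertex-off-cap : ∀ {i} e → i ≤ suc t →
    let a = capKind (proj₁ (capEnds e)) ; b = capKind (proj₂ (capEnds e)) in
    v (2 + i) ≢ a → v (2 + i) ≢ b → ¬ Incident (pos (v (2 + i))) (pos a) (pos b)
  row-vertex-off-cap V0V1 _ _ _ = off-below ≤-compute ≤-compute
  row-vertex-off-cap S0V0 _ _ _ = off-below ≤-compute ≤-compute
  row-vertex-off-cap S0V1 _ _ _ = off-below ≤-compute ≤-compute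
  row-vertex-off-cap S1V0 _ _ _ = off-below ≤-compute ≤-compute
  row-vertex-off-cap S1V1 _ _ _ = off-below ≤-compute ≤-compute
  row-vertex-off-cap SLV0 _ _ _ rewrite last-shadow-above = off-below ≤-compute ≤-compute
  row-vertex-off-cap S0VL i≤1+t _ u≢b with ℕP.m≤n⇒m<n∨m≡n i≤1+t
  ... | inj₁ i<1+t = off-left (+-double-< 4 5 i<1+t ≤-compute) (+-double-< 4 4 i<1+t ≤-compute)
  ... | inj₂ refl = ⊥-elim (u≢b refl)
  row-vertex-off-cap VLV0 i≤1+t u≢a _ with ℕP.m≤n⇒m<n∨m≡n i≤1+t
  ... | inj₁ i<1+t = off-left (+-double-< 4 4 i<1+t ≤-compute) (+-double-< 4 4 i<1+t ≤-compute)
  ... | inj₂ refl = ⊥-elim (u≢a refl)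
  row-vertex-off-cap {zero} S1V2 _ _ u≢b = ⊥-elim (u≢b refl)
  row-vertex-off-cap {suc i} S1V2 _ _ _ = off-right (+-double-≤ 6 6 ℕP.≤-refl z≤n) (+-double-≤ 5 6 ≤-compute z≤n)
  row-vertex-off-cap {zero} V1V2 _ _ u≢b = ⊥-elim (u≢b refl)
  row-vertex-off-cap {suc i} V1V2 _ _ _ = off-right (+-double-≤ 5 6 ≤-compute z≤n) (+-double-≤ 5 6 ≤-compute z≤n)
  row-vertex-off-cap {zero} S2V1 _ _ _ = off-line (λ ())
  row-vertex-off-cap {suc i} S2V1 _ _ _ = off-right (+-double-≤ 4 6 ≤-compute z≤n) (+-double-≤ 5 6 ≤-compute z≤n)

  shadow-off-cap : ∀ {i} e → i ≤ suc t →
    let a = capKind (proj₁ (capEnds e)) ; b = capKind (proj₂ (capEnds e)) in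
    s (2 + i) ≢ a → s (2 + i) ≢ b → ¬ Incident (pos (s (2 + i))) (pos a) (pos b)
  shadow-off-cap {i} V0V1 _ _ _ = off-below (side< i ≤-compute) (side< i ≤-compute)
  shadow-off-cap {i} S0V0 _ _ _ = off-below (side< i ≤-compute) (side< i ≤-compute)
  shadow-off-cap {i} S0V1 _ _ _ = off-below (side< i ≤-compute) (side< i ≤-compute)
  shadow-off-cap {i} S1V0 _ _ _ = off-below (side< i ≤-compute) (side< i ≤-compute)
  shadow-off-cap {i} S1V1 _ _ _ = off-below (side< i ≤-compute) (side< i ≤-compute)
  shadow-off-cap S0VL i≤1+t _ _ =
    off-left (+-double-< 3 3 (s≤s i≤1+t) ≤-compute) (+-double-< 3 2 (s≤s i≤1+t) ≤-compute)
  shadow-off-cap VLV0 i≤1+t _ _ =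
    off-left (+-double-< 3 2 (s≤s i≤1+t) ≤-compute) (+-double-< 3 2 (s≤s i≤1+t) ≤-compute)
  shadow-off-cap SLV0 i≤1+t u≢a _ with ℕP.m≤n⇒m<n∨m≡n i≤1+t
  ... | inj₁ i<1+t = off-left (+-double-< 3 3 i<1+t ≤-compute) (+-double-< 3 4 i<1+t ≤-compute)
  ... | inj₂ refl = ⊥-elim (u≢a refl)
  shadow-off-cap {zero} S1V2 _ _ _ = off-left ≤-compute ≤-compute
  shadow-off-cap {suc zero} S1V2 _ _ _ = off-line (λ ())
  shadow-off-cap {suc (suc i)} S1V2 _ _ _ = off-right (+-double-≤ 6 7 ≤-compute z≤n) (+-double-≤ 5 7 ≤-compute z≤n)
  shadow-off-cap {zero} V1V2 _ _ _ = off-left ≤-compute ≤-compute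
  shadow-off-cap {suc i} V1V2 _ _ _ = off-right (+-double-≤ 5 5 ≤-compute z≤n) (+-double-≤ 5 5 ≤-compute z≤n)
  shadow-off-cap {zero} S2V1 _ u≢a _ = ⊥-elim (u≢a refl)
  shadow-off-cap {suc i} S2V1 _ _ _ = off-right (+-double-≤ 4 5 ≤-compute z≤n) (+-double-≤ 5 5 ≤-compute z≤n)

  vertex-off : ∀ {u a b} → Valid u → Link a b → u ≢ a → u ≢ b → ¬ Incident (pos u) (pos a) (pos b)
  vertex-off {v 0} _ (cap e) = cap-vertex-off (cap-vertices-off V0 e)
  vertex-off {v 1} _ (cap e) = cap-vertex-off (cap-vertices-off V1 e)
  vertex-off {s 0} _ (cap e) = cap-vertex-off (cap-vertices-off S0 e)
  vertex-off {s 1} _ (cap e) = cap-vertex-off (cap-vertices-off S1 e)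
  vertex-off {v (suc (suc i))} (s≤s (s≤s (s≤s i≤1+t))) (cap e) = row-vertex-off-cap e i≤1+t
  vertex-off {s (suc (suc i))} (s≤s (s≤s (s≤s i≤1+t))) (cap e) = shadow-off-cap e i≤1+t
  vertex-off _ (path _) = vertex-off-path
  vertex-off _ (spoke near _ _) = vertex-off-spoke near

  successor-link : ∀ a → suc a < 4 + t → Link (v a) (v (suc a))
  successor-link 0 _ = cap V0V1
  successor-link 1 _ = cap V1V2
  successor-link (suc (suc j)) (s≤s (s≤s (s≤s (s≤s j≤t)))) = path j≤t

  cycle-link : ∀ {a b} → a < 4 + t → b < 4 + t → CycleNeighbours (4 + t) a b →
    Link (v a) (v b) ⊎ Link (v b) (v a)
  cycle-link {a} _ b<n (inj₁ refl) = inj₁ (successor-link a b<n)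
  cycle-link {b = b} a<n _ (inj₂ (inj₁ refl)) = inj₂ (successor-link b a<n)
  cycle-link _ _ (inj₂ (inj₂ (inj₁ (refl , refl)))) = inj₁ (cap VLV0)
  cycle-link _ _ (inj₂ (inj₂ (inj₂ (refl , refl)))) = inj₂ (cap VLV0)

  shadow-link : ∀ {a b} → a < 4 + t → b < 4 + t → b ≡ a ⊎ CycleNeighbours (4 + t) b a → Link (s b) (v a)
  shadow-link {0} _ _ (inj₁ refl) = cap S0V0
  shadow-link {1} _ _ (inj₁ refl) = cap S1V1
  shadow-link {suc (suc c)} _ (s≤s (s≤s (s≤s c≤))) (inj₁ refl) = spoke same c≤ c≤
  shadow-link {b = 0} _ _ (inj₂ (inj₁ refl)) = cap S0V1
  shadow-link {b = 1} _ _ (inj₂ (inj₁ refl)) = cap S1V2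
  shadow-link {b = suc (suc c)} (s≤s (s≤s (s≤s 1+c≤))) (s≤s (s≤s (s≤s c≤))) (inj₂ (inj₁ refl)) =
    spoke next c≤ 1+c≤
  shadow-link {0} _ _ (inj₂ (inj₂ (inj₁ refl))) = cap S1V0
  shadow-link {1} _ _ (inj₂ (inj₂ (inj₁ refl))) = cap S2V1
  shadow-link {suc (suc j)} (s≤s (s≤s (s≤s j≤))) (s≤s (s≤s (s≤s 1+j≤))) (inj₂ (inj₂ (inj₁ refl))) =
    spoke prev 1+j≤ j≤
  shadow-link _ _ (inj₂ (inj₂ (inj₂ (inj₁ (refl , refl))))) = cap SLV0
  shadow-link _ _ (inj₂ (inj₂ (inj₂ (inj₂ (refl , refl))))) = cap S0VL

  label : Fin (4 + t) ⊎ Fin (4 + t) → Kind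
  label (inj₁ i) = v (toℕ i)
  label (inj₂ i) = s (toℕ i)

  label-injective : ∀ x y → label x ≡ label y → x ≡ y
  label-injective (inj₁ i) (inj₁ j) e = cong inj₁ (toℕ-injective (cong index e))
  label-injective (inj₂ i) (inj₂ j) e = cong inj₂ (toℕ-injective (cong index e))
  label-injective (inj₁ _) (inj₂ _) ()
  label-injective (inj₂ _) (inj₁ _) ()

  label-valid : ∀ x → Valid (label x)
  label-valid (inj₁ i) = toℕ<n i
  label-valid (inj₂ i) = toℕ<n i

  classify : ∀ {x y} → Adj (GreatShadow (Cycle (4 + t))) x y →
    Link (label x) (label y) ⊎ Link (label y) (label x)
  classify {inj₁ i} {inj₁ j} adj = cycle-link (toℕ<n i) (toℕ<n j) adj
  classify {inj₁ i} {inj₂ j} adj =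
    inj₂ (shadow-link (toℕ<n i) (toℕ<n j) (Sum.map₁ (cong toℕ ∘ sym) adj))
  classify {inj₂ i} {inj₁ j} adj = inj₁ (shadow-link (toℕ<n j) (toℕ<n i) (Sum.map₁ (cong toℕ) adj))

  shadow-cycle-planar : Planar (GreatShadow (Cycle (4 + t)))
  shadow-cycle-planar =
    straightLineEmbedding label pos Link label-injective pos-injective classify vertex-off′ links-apart′
    where
    vertex-off′ : ∀ x {a b} → Link a b → label x ≢ a → label x ≢ b →
      ¬ OnSegment (pos (label x)) (pos a) (pos b)
    vertex-off′ x link x≢a x≢b = vertex-off (label-valid x) link x≢a x≢b ∘ incident
    links-apart′ : ∀ {a b c d} → Link a b → Link c d → a ≢ c → a ≢ d → b ≢ c → b ≢ d →
      ¬ ProperCross (pos a) (pos b) (pos c) (pos d)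
    links-apart′ l l′ a≢c a≢d b≢c b≢d = links-apart l l′ a≢c a≢d b≢c b≢d ∘ crossing

side-odd : ∀ r → side (suc (r * 2)) ≡ 2
side-odd zero = refl
side-odd (suc r) = side-odd r

lemma8 : (n : ℕ) → 3 ≤ n → 2 ∣ n → Planar (GreatShadow (Cycle n))
lemma8 _ _ (divides (suc (suc r)) refl) = Drawing.shadow-cycle-planar (r * 2) (side-odd r)
lemma8 _ 3≤n (divides 0 refl) with 3≤n
... | ()
lemma8 _ 3≤n (divides 1 refl) with 3≤n
... | s≤s (s≤s ())
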